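{- Let $n\ge 1$, $X\subseteq B^n$, and let $G=Q_n(X)$ be a daisy cube. For every edge $ab$ of $G$, the induced subgraphs $\langle W_{ab}\rangle$ and $\langle W_{ba}\rangle$ are (isomorphic to) daisy cubes.
   Context: $B=\{0,1\}$; $Q_n$ has vertex set $B^n$ (binary strings of length $n$), two strings adjacent iff they differ in exactly one position. For $u,v\in B^n$ write $u\le v$ if $u_i\le v_i$ for all $i$. For $X\subseteq B^n$ the daisy cube $Q_n(X)$ is the subgraph of $Q_n$ induced by $\{u: u\le x\text{ for some } x\in X\}$; a graph is called a daisy cube if it is isomorphic to some $Q_m(Y)$. For an edge $ab$ of $G$ (distances in $G$): $W_{ab}=\{w\in V(G): d(a,w)<d(b,w)\}$, $W_{ba}=\{w\in V(G): d(b,w)<d(a,w)\}$. $\langle S\rangle$ denotes the subgraph of $G$ induced by $S$. -}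

module Defs where

open import Data.Nat using (ℕ; zero; suc; _≤_; _<_)
open import Data.Bool using (Bool)
import Data.Bool as B
open import Data.Fin using (Fin)
open import Data.Vec using (Vec; lookup)
open import Data.List using (List)
open import Data.List.Relation.Unary.Any using (Any)
open import Data.Product using (Σ; ∃; _×_; ∃-syntax)
open import Relation.Binary.PropositionalEquality using (_≡_; _≢_)

Bn : ℕ → Set
Bn n = Vec Bool n

_≼_ : ∀ {n} → Bn n → Bn n → Set
_≼_ {n} u v = ∀ (i : Fin n) → lookup u i B.≤ lookup v i

Adj : ∀ {n} → Bn n → Bn n → Set
Adj {n} u v = Σ (Fin n) λ i → (lookup u i ≢ lookup v i) × (∀ (j : Fin n) → j ≢ i → lookup u j ≡ lookup v j)

-- vertex set of the daisy cube Q_n(X), X a finite subset of B^n given as a list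
DaisyV : ∀ {n} → List (Bn n) → Bn n → Set
DaisyV X u = Any (λ x → u ≼ x) X

data Walk {n} (V : Bn n → Set) : Bn n → Bn n → ℕ → Set where
  nil  : ∀ {u} → V u → Walk V u u 0
  cons : ∀ {u v w k} → V u → Adj u v → Walk V v w k → Walk V u w (suc k)

IsDist : ∀ {n} → (Bn n → Set) → Bn n → Bn n → ℕ → Set
IsDist V u w k = Walk V u w k × (∀ l → Walk V u w l → k ≤ l)

W : ∀ {n} → (Bn n → Set) → Bn n → Bn n → Bn n → Set
W V a b w = V w × ∃[ k ] ∃[ l ] (IsDist V a w k × IsDist V b w l × k < l)

record Iso {n m} (S : Bn n → Set) (T : Bn m → Set) : Set where
  field
    to      : Bn n → Bn m
    from    : Bn m → Bn n
    to-T    : ∀ u → S u → T (to u)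
    from-S  : ∀ v → T v → S (from v)
    from-to : ∀ u → S u → from (to u) ≡ u
    to-from : ∀ v → T v → to (from v) ≡ v
    adj-to  : ∀ u v → S u → S v → Adj u v → Adj (to u) (to v)
    adj-from : ∀ u v → S u → S v → Adj (to u) (to v) → Adj u v

IsDaisyCube : ∀ {n} → (Bn n → Set) → Set
IsDaisyCube S = ∃[ m ] ∃[ Y ] Iso S (DaisyV {m} Y)

module Submission where

-- Let G = Q_n(X).  Its vertex set is down-closed for ≼, and for
-- any down-closed vertex set the graph distance equals the Hamming distance:
-- a walk changes one coordinate per step, so it is never shorter, and a
-- shortest walk from u to w exists inside G, descending from u to the meet
-- u ∧ w and then ascending to w.  If ab is an edge in direction i, every
-- vertex w is one step closer (in Hamming distance) to whichever of a, b
-- agrees with w in coordinate i, so W_ab is the slice {w ∈ G : w_i = a_i}.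
-- Finally, the slice {w ∈ Q_n(X) : w_i = c} is isomorphic to the daisy cube
-- Q_n(Y), where Y consists of the generators x ∈ X with c ≤ x_i with
-- coordinate i cleared; the isomorphism clears, resp. restores, coordinate i.

open import Defs
open import Data.Nat using (ℕ; zero; suc; _+_; _≤_; _<_; _≥_; s≤s)
open import Data.Nat.Properties
  using (≤-trans; ≤-reflexive; ≤-antisym; n≤1+n; <-asym; +-suc; suc-injective; +-commutativeSemigroup)
open import Algebra.Properties.CommutativeSemigroup +-commutativeSemigroup using (interchange)
open import Data.Bool using (Bool; true; false; _∧_)
import Data.Bool as B
import Data.Bool.Properties as BP
open import Data.Fin using (Fin; zero; suc; _≟_)
import Data.Fin.Properties as Fin
open import Data.Vec using ([]; _∷_; lookup; tabulate; zipWith; _[_]≔_)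
open import Data.Vec.Properties
  using (lookup∘update; lookup∘update′; []≔-idempotent; []≔-lookup; tabulate-cong; tabulate∘lookup)
open import Data.List using (List; map; filter)
import Data.List.Relation.Unary.Any as Any
open import Data.List.Membership.Propositional using (find; lose)
open import Data.List.Membership.Propositional.Properties using (∈-map⁺; ∈-map⁻; ∈-filter⁺; ∈-filter⁻)
open import Data.Product using (_×_; _,_; proj₁; proj₂; Σ)
open import Function using (_∘_)
open import Relation.Binary.PropositionalEquality
open import Relation.Nullary using (yes; no; contradiction)

δ : Bool → Bool → ℕ
δ false false = 0
δ false true  = 1
δ true  false = 1
δ true  true  = 0

ham : ∀ {n} → Bn n → Bn n → ℕ
ham []      []      = 0
ham (x ∷ u) (y ∷ v) = δ x y + ham u v

ham-refl : ∀ {n} (u : Bn n) → ham u u ≡ 0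
ham-refl []          = refl
ham-refl (false ∷ u) = ham-refl u
ham-refl (true ∷ u)  = ham-refl u

ham≡0⇒≡ : ∀ {n} (u v : Bn n) → ham u v ≡ 0 → u ≡ v
ham≡0⇒≡ []          []          _ = refl
ham≡0⇒≡ (false ∷ u) (false ∷ v) e = cong (false ∷_) (ham≡0⇒≡ u v e)
ham≡0⇒≡ (true ∷ u)  (true ∷ v)  e = cong (true ∷_) (ham≡0⇒≡ u v e)

lookup-ext : ∀ {n} (u v : Bn n) → (∀ j → lookup u j ≡ lookup v j) → u ≡ v
lookup-ext u v same = begin
  u                   ≡⟨ sym (tabulate∘lookup u) ⟩
  tabulate (lookup u) ≡⟨ tabulate-cong same ⟩
  tabulate (lookup v) ≡⟨ tabulate∘lookup v ⟩
  v                   ∎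
  where open ≡-Reasoning

AdjAt : ∀ {n} → Fin n → Bn n → Bn n → Set
AdjAt {n} i u v = lookup u i ≢ lookup v i × (∀ (j : Fin n) → j ≢ i → lookup u j ≡ lookup v j)

adjAt-sym : ∀ {n} {i : Fin n} (u v : Bn n) → AdjAt i u v → AdjAt i v u
adjAt-sym u v (differ , agree) = differ ∘ sym , λ j j≢i → sym (agree j j≢i)

adjAt-tail : ∀ {n} {i : Fin n} {x y} {u v : Bn n} → AdjAt (suc i) (x ∷ u) (y ∷ v) → AdjAt i u v
adjAt-tail (differ , agree) = differ , λ j j≢i → agree (suc j) (j≢i ∘ Fin.suc-injective)

ham-flip : ∀ {n} (i : Fin n) (a b w : Bn n) → AdjAt i a b → lookup w i ≡ lookup a i →
           ham b w ≡ suc (ham a w)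
ham-flip zero (false ∷ a) (true ∷ b) (z ∷ w) (_ , agree) refl =
  cong (λ v → suc (ham v w)) (sym (lookup-ext a b λ j → agree (suc j) λ ()))
ham-flip zero (true ∷ a) (false ∷ b) (z ∷ w) (_ , agree) refl =
  cong (λ v → suc (ham v w)) (sym (lookup-ext a b λ j → agree (suc j) λ ()))
ham-flip zero (false ∷ a) (false ∷ b) _ (differ , _) _ = contradiction refl differ
ham-flip zero (true ∷ a)  (true ∷ b)  _ (differ , _) _ = contradiction refl differ
ham-flip (suc i) (x ∷ a) (y ∷ b) (z ∷ w) ab eq with proj₂ ab zero (λ ())
... | refl = trans (cong (δ x z +_) (ham-flip i a b w (adjAt-tail ab) eq)) (+-suc (δ x z) (ham a w))

ham-step : ∀ {n} {i : Fin n} (u v w : Bn n) → AdjAt i u v → ham u w ≤ suc (ham v w)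
ham-step {i = i} u v w uv with lookup w i B.≟ lookup v i
... | yes w≡v = ≤-reflexive (ham-flip i v u w (adjAt-sym u v uv) w≡v)
... | no w≢v  = ≤-trans (≤-trans (n≤1+n _) (≤-reflexive (sym (ham-flip i u v w uv w≡u)))) (n≤1+n _)
  where
  w≡u : lookup w i ≡ lookup u i
  w≡u = trans (BP.¬-not w≢v) (sym (BP.¬-not (proj₁ uv)))

snoc : ∀ {n} {V : Bn n → Set} {u v w k} → Walk V u v k → V w → Adj v w → Walk V u w (suc k)
snoc (nil Vu)       Vw vw = cons Vu vw (nil Vw)
snoc (cons Vu uv r) Vw vw = cons Vu uv (snoc r Vw vw)

reverse : ∀ {n} {V : Bn n → Set} {u w k} → Walk V u w k → Walk V w u k
reverse (nil Vu)                     = nil Vu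
reverse (cons {u} {v} Vu (i , uv) r) = snoc (reverse r) Vu (i , adjAt-sym u v uv)

append : ∀ {n} {V : Bn n → Set} {u v w k l} → Walk V u v k → Walk V v w l → Walk V u w (k + l)
append (nil _)        s = s
append (cons Vu uv r) s = cons Vu uv (append r s)

walk-length : ∀ {n} {V : Bn n → Set} {u w : Bn n} {l} → Walk V u w l → ham u w ≤ l
walk-length (nil {u} _)                     = ≤-reflexive (ham-refl u)
walk-length (cons {u} {v} {w} _ (_ , uv) r) = ≤-trans (ham-step u v w uv) (s≤s (walk-length r))

dist-unique : ∀ {n} {V : Bn n → Set} {u w k l} → IsDist V u w k → IsDist V u w l → k ≡ l
dist-unique (r , min-r) (s , min-s) = ≤-antisym (min-r _ s) (min-s _ r)

≼-refl : ∀ {n} (u : Bn n) → u ≼ u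
≼-refl u i = BP.≤-refl

≼-trans : ∀ {n} (u v w : Bn n) → u ≼ v → v ≼ w → u ≼ w
≼-trans u v w u≼v v≼w i = BP.≤-trans (u≼v i) (v≼w i)

≼-update : ∀ {n} (i : Fin n) {x y : Bool} (u v : Bn n) → u ≼ v → x B.≤ y → (u [ i ]≔ x) ≼ (v [ i ]≔ y)
≼-update i {x} {y} u v u≼v x≤y j with j ≟ i
... | yes refl = subst₂ B._≤_ (sym (lookup∘update i u x)) (sym (lookup∘update i v y)) x≤y
... | no j≢i   = subst₂ B._≤_ (sym (lookup∘update′ j≢i u x)) (sym (lookup∘update′ j≢i v y)) (u≼v j)

restore : ∀ {n} (i : Fin n) {c y : Bool} (u : Bn n) → lookup u i ≡ c → (u [ i ]≔ y) [ i ]≔ c ≡ u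
restore i u refl = trans ([]≔-idempotent u i) ([]≔-lookup u i)

update-adjAt : ∀ {n} (j : Fin n) {x : Bool} (u : Bn n) → lookup u j ≢ x → AdjAt j u (u [ j ]≔ x)
update-adjAt j {x} u u≢x =
  (λ e → u≢x (trans e (lookup∘update j u x))) , λ k k≢j → sym (lookup∘update′ k≢j u x)

adj-set : ∀ {n} (i : Fin n) (x : Bool) (u v : Bn n) → lookup u i ≡ lookup v i → Adj u v →
          Adj (u [ i ]≔ x) (v [ i ]≔ x)
adj-set i x u v same-i (j , differ , agree) with j ≟ i
... | yes refl = contradiction same-i differ
... | no j≢i   = j , differ′ , agree′
  where
  differ′ : lookup (u [ i ]≔ x) j ≢ lookup (v [ i ]≔ x) j
  differ′ e = differ (trans (sym (lookup∘update′ j≢i u x)) (trans e (lookup∘update′ j≢i v x)))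
  agree′ : ∀ k → k ≢ j → lookup (u [ i ]≔ x) k ≡ lookup (v [ i ]≔ x) k
  agree′ k k≢j with k ≟ i
  ... | yes refl = trans (lookup∘update k u x) (sym (lookup∘update k v x))
  ... | no k≢i   = trans (lookup∘update′ k≢i u x) (trans (agree k k≢j) (sym (lookup∘update′ k≢i v x)))

DownClosed : ∀ {n} → (Bn n → Set) → Set
DownClosed V = ∀ u v → u ≼ v → V v → V u

daisy-down : ∀ {n} (X : List (Bn n)) → DownClosed (DaisyV X)
daisy-down X u v u≼v = Any.map (λ {x} → ≼-trans u v x u≼v)

closer : ∀ {n} (u m : Bn n) k → ham u m ≡ suc k →
         Σ (Fin n) λ j → lookup u j ≢ lookup m j × ham (u [ j ]≔ lookup m j) m ≡ k
closer []          []          k ()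
closer (false ∷ u) (true ∷ m)  k e = zero , (λ ()) , suc-injective e
closer (true ∷ u)  (false ∷ m) k e = zero , (λ ()) , suc-injective e
closer (false ∷ u) (false ∷ m) k e with closer u m k e
... | j , differ , e′ = suc j , differ , e′
closer (true ∷ u)  (true ∷ m)  k e with closer u m k e
... | j , differ , e′ = suc j , differ , e′

descent : ∀ {n} {V : Bn n → Set} → DownClosed V → ∀ k {u m : Bn n} → V u → m ≼ u → ham u m ≡ k →
          Walk V u m k
descent down zero {u} {m} Vu m≼u e with ham≡0⇒≡ u m e
... | refl = nil Vu
descent {V = V} down (suc k) {u} {m} Vu m≼u e with closer u m k e
... | j , differ , e′ = cons Vu (j , update-adjAt j u differ) (descent down k {u′} Vu′ m≼u′ e′)
  where
  u′ : Bn _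
  u′ = u [ j ]≔ lookup m j
  u′≼u : u′ ≼ u
  u′≼u = subst (u′ ≼_) ([]≔-lookup u j) (≼-update j u u (≼-refl u) (m≼u j))
  m≼u′ : m ≼ u′
  m≼u′ = subst (_≼ u′) ([]≔-lookup m j) (≼-update j m u m≼u BP.≤-refl)
  Vu′ : V u′
  Vu′ = down u′ u u′≼u Vu

meet : ∀ {n} → Bn n → Bn n → Bn n
meet = zipWith _∧_

meet≼ˡ : ∀ {n} (u w : Bn n) → meet u w ≼ u
meet≼ˡ (false ∷ u) (z ∷ w)     zero    = B.b≤b
meet≼ˡ (true ∷ u)  (false ∷ w) zero    = B.f≤t
meet≼ˡ (true ∷ u)  (true ∷ w)  zero    = B.b≤b
meet≼ˡ (x ∷ u)     (z ∷ w)     (suc i) = meet≼ˡ u w i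

meet≼ʳ : ∀ {n} (u w : Bn n) → meet u w ≼ w
meet≼ʳ (false ∷ u) (false ∷ w) zero    = B.b≤b
meet≼ʳ (false ∷ u) (true ∷ w)  zero    = B.f≤t
meet≼ʳ (true ∷ u)  (z ∷ w)     zero    = B.b≤b
meet≼ʳ (x ∷ u)     (z ∷ w)     (suc i) = meet≼ʳ u w i

δ-meet : ∀ x z → δ x z ≡ δ x (x ∧ z) + δ z (x ∧ z)
δ-meet false false = refl
δ-meet false true  = refl
δ-meet true  false = refl
δ-meet true  true  = refl

ham-meet : ∀ {n} (u w : Bn n) → ham u w ≡ ham u (meet u w) + ham w (meet u w)
ham-meet []      []      = refl
ham-meet (x ∷ u) (z ∷ w) =
  trans (cong₂ _+_ (δ-meet x z) (ham-meet u w))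
        (interchange (δ x (x ∧ z)) (δ z (x ∧ z)) (ham u (meet u w)) (ham w (meet u w)))

dist-ham : ∀ {n} {V : Bn n → Set} → DownClosed V → ∀ {u w} → V u → V w → IsDist V u w (ham u w)
dist-ham {V = V} down {u} {w} Vu Vw = geodesic , λ _ → walk-length
  where
  geodesic : Walk V u w (ham u w)
  geodesic = subst (Walk V u w) (sym (ham-meet u w))
    (append (descent down _ Vu (meet≼ˡ u w) refl) (reverse (descent down _ Vw (meet≼ʳ u w) refl)))

module HalfSpace {n} {V : Bn n → Set} (down : DownClosed V) {i : Fin n} {a b : Bn n}
                 (Va : V a) (Vb : V b) (ab : AdjAt i a b) where

  W⇒slice : ∀ w → W V a b w → V w × lookup w i ≡ lookup a i
  W⇒slice w (Vw , k , l , dk , dl , k<l) with lookup w i B.≟ lookup a i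
  ... | yes w≡a = Vw , w≡a
  ... | no w≢a  = contradiction farther-from-a (<-asym closer-to-a)
    where
    farther-from-a : ham b w < ham a w
    farther-from-a = ≤-reflexive (sym (ham-flip i b a w (adjAt-sym a b ab)
                       (trans (BP.¬-not w≢a) (sym (BP.¬-not (proj₁ (adjAt-sym a b ab)))))))
    closer-to-a : ham a w < ham b w
    closer-to-a = subst₂ _<_ (dist-unique dk (dist-ham down Va Vw)) (dist-unique dl (dist-ham down Vb Vw)) k<l

  slice⇒W : ∀ w → V w × lookup w i ≡ lookup a i → W V a b w
  slice⇒W w (Vw , w≡a) = Vw , ham a w , ham b w , dist-ham down Va Vw , dist-ham down Vb Vw ,
                         ≤-reflexive (sym (ham-flip i a b w ab w≡a))

Iso-resp : ∀ {n m} {S S′ : Bn n → Set} {T : Bn m → Set} →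
           (∀ w → S w → S′ w) → (∀ w → S′ w → S w) → Iso S′ T → Iso S T
Iso-resp S⇒S′ S′⇒S I = record
  { to = to ; from = from ; to-from = to-from
  ; to-T     = λ u s → to-T u (S⇒S′ u s)
  ; from-S   = λ v t → S′⇒S _ (from-S v t)
  ; from-to  = λ u s → from-to u (S⇒S′ u s)
  ; adj-to   = λ u v su sv → adj-to u v (S⇒S′ u su) (S⇒S′ v sv)
  ; adj-from = λ u v su sv → adj-from u v (S⇒S′ u su) (S⇒S′ v sv)
  }
  where open Iso I

Slice : ∀ {n} → List (Bn n) → Fin n → Bool → Bn n → Set
Slice X i c w = DaisyV X w × lookup w i ≡ c

sliceGen : ∀ {n} → Fin n → Bool → List (Bn n) → List (Bn n)
sliceGen i c X = map (λ x → x [ i ]≔ false) (filter (λ x → c BP.≤? lookup x i) X)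

module _ {n} (X : List (Bn n)) (i : Fin n) (c : Bool) where

  clear : Bn n → Bn n
  clear u = u [ i ]≔ false

  slice⇒gen : ∀ u → Slice X i c u → DaisyV (sliceGen i c X) (clear u)
  slice⇒gen u (Vu , refl) with find Vu
  ... | x , x∈X , u≼x =
    lose (∈-map⁺ clear (∈-filter⁺ (λ x → c BP.≤? lookup x i) x∈X (u≼x i))) (≼-update i u x u≼x BP.≤-refl)

  gen⇒slice : ∀ v → DaisyV (sliceGen i c X) v → Slice X i c (v [ i ]≔ c) × lookup v i ≡ false
  gen⇒slice v Vv with find Vv
  ... | y , y∈Y , v≼y with ∈-map⁻ clear y∈Y
  ... | x , x∈F , refl with ∈-filter⁻ (λ x → c BP.≤? lookup x i) x∈F
  ... | x∈X , c≤xᵢ = (lose x∈X v′≼x , lookup∘update i v c) , vᵢ≡false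
    where
    v′≼x : (v [ i ]≔ c) ≼ x
    v′≼x = subst ((v [ i ]≔ c) ≼_) (restore i x refl) (≼-update i v (clear x) v≼y c≤xᵢ)
    vᵢ≡false : lookup v i ≡ false
    vᵢ≡false = BP.≤-antisym (subst (lookup v i B.≤_) (lookup∘update i x false) (v≼y i)) (BP.≤-minimum _)

  slice-iso : Iso (Slice X i c) (DaisyV (sliceGen i c X))
  slice-iso = record
    { to       = clear
    ; from     = λ v → v [ i ]≔ c
    ; to-T     = slice⇒gen
    ; from-S   = λ v t → proj₁ (gen⇒slice v t)
    ; from-to  = λ u s → restore i u (proj₂ s)
    ; to-from  = λ v t → restore i v (proj₂ (gen⇒slice v t))
    ; adj-to   = λ u v su sv → adj-set i false u v (trans (proj₂ su) (sym (proj₂ sv)))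
    ; adj-from = λ u v su sv uv →
        subst₂ Adj (restore i u (proj₂ su)) (restore i v (proj₂ sv))
          (adj-set i c (clear u) (clear v) (trans (lookup∘update i u false) (sym (lookup∘update i v false))) uv)
    }

W-daisy : ∀ {n} (X : List (Bn n)) {i : Fin n} {a b : Bn n} →
          DaisyV X a → DaisyV X b → AdjAt i a b → IsDaisyCube (W (DaisyV X) a b)
W-daisy {n} X {i} {a} {b} Va Vb ab =
  n , sliceGen i (lookup a i) X , Iso-resp W⇒slice slice⇒W (slice-iso X i (lookup a i))
  where open HalfSpace {V = DaisyV X} (daisy-down X) {i} {a} {b} Va Vb ab

proposition2p4 : (n : ℕ) → n ≥ 1 → (X : List (Bn n)) → (a b : Bn n) → DaisyV X a → DaisyV X b → Adj a b → IsDaisyCube (W (DaisyV X) a b) × IsDaisyCube (W (DaisyV X) b a)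
proposition2p4 n _ X a b Va Vb (i , ab) = W-daisy X Va Vb ab , W-daisy X Vb Va (adjAt-sym a b ab)
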